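{- There exists a constant $C>0$ such that for all $n\geq 2$, $r_{K_4}(n)\leq\exp(C\sqrt{\log n})$.
   Context: $\log$ is the natural logarithm. $K_n$ is the complete graph on $[n]$ and $K_4$ the complete graph on four vertices. An edge coloring $\chi$ of $K_n$ admits an even-chromatic copy of a graph $H$ if there is an injective map $f\colon V(H)\to[n]$ such that every color appears on an even number (possibly zero) of the edges $f(u)f(v)$, $uv\in E(H)$. $r_H(n)$ is the minimum number of colors in an edge coloring of $K_n$ admitting no even-chromatic copy of $H$. -}

module Defs where

open import Data.Nat using (ℕ; _≤_; _*_; _^_)
open import Data.Nat.Divisibility using (_∣_)
open import Data.Nat.Logarithm using (⌊log₂_⌋; ⌈log₂_⌉)
open import Data.Fin using (Fin; zero; suc)
open import Data.Fin.Properties using (_≟_)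
open import Data.List using (List; []; _∷_; length; filter)
open import Data.Product using (Σ; _×_; ∃-syntax)
open import Relation.Binary.PropositionalEquality using (_≡_)
open import Relation.Nullary using (¬_)
open import Function.Definitions using (Injective)

-- An edge colouring of K_n with (at most) k colours: a symmetric map on
-- pairs of vertices (the diagonal values are irrelevant, never used).
record Coloring (n k : ℕ) : Set where
  field
    col  : Fin n → Fin n → Fin k
    symm : ∀ i j → col i j ≡ col j i
open Coloring public

occurrences : {k : ℕ} → Fin k → List (Fin k) → ℕ
occurrences c xs = length (filter (_≟ c) xs)

k4EdgeColors : {n k : ℕ} → Coloring n k → (Fin 4 → Fin n) → List (Fin k)
k4EdgeColors χ f =
    col χ (f v0) (f v1) ∷ col χ (f v0) (f v2) ∷ col χ (f v0) (f v3)
  ∷ col χ (f v1) (f v2) ∷ col χ (f v1) (f v3) ∷ col χ (f v2) (f v3) ∷ []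
  where
  v0 v1 v2 v3 : Fin 4
  v0 = zero
  v1 = suc zero
  v2 = suc (suc zero)
  v3 = suc (suc (suc zero))

EvenChromaticK4 : {n k : ℕ} → Coloring n k → Set
EvenChromaticK4 {n} {k} χ =
  ∃[ f ] (Injective _≡_ _≡_ f ×
          ((c : Fin k) → 2 ∣ occurrences c (k4EdgeColors {n} χ f)))

-- "r_{K_4}(n) ≤ k": some colouring of K_n with at most k colours admits
-- no even-chromatic K_4 (r is a minimum, so this unfolds r ≤ k).
RK4AtMost : ℕ → ℕ → Set
RK4AtMost n k = Σ (Coloring n k) λ χ → ¬ EvenChromaticK4 χ

-- Embed the vertices of K_n into [m]^d and colour an edge xy by the ordered pair of values at
-- the first coordinate where x and y differ, together with the vector recording, coordinate by
-- coordinate, whether the endpoint that is smaller at that first coordinate lies below the other.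
-- This uses m²2^d colours, which is 2^(3s) for m = 2^s and d = s ≈ √(log₂ n).
-- Given four distinct vertices, drop the coordinates where all four agree and look at the first
-- remaining one. If some value α occurs there exactly once, the number of edges joining a vertex
-- with value α to one without is odd, so some colour occurs an odd number of times. Otherwise the
-- four vertices form two pairs, with values a < b. Evenness forces the two inner edges to have the
-- same colour, which yields a coordinate j at which both pairs take the same two distinct values;
-- then exactly one of the four cross edges records "below" at j.
module Submission where

open import Data.Bool using (Bool; true; false; not; _∧_; _∨_; _xor_)
import Data.Bool.Properties as Bool
open import Data.Fin using (Fin; zero; suc; combine; fromℕ<; inject≤; finToFun; funToFin)
import Data.Fin as Fin
open import Data.Fin.Patterns using (0F; 1F; 2F; 3F)
open import Data.Fin.Properties
  using (_≟_; <-cmp; <-irrefl; <-asym; combine-injective; inject≤-injective; funToFin-finToFin)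
open import Data.List using (List; []; _∷_; _++_; length; filter; filterᵇ; map)
open import Data.List.Properties using (filter-notAll; filter-++; filter-none; filter-accept; filter-≐)
open import Data.List.Relation.Unary.All using (All; []; _∷_)
open import Data.List.Relation.Unary.Any using (here)
open import Data.List.Relation.Binary.Permutation.Propositional
  using (_↭_; ↭⇒↭ₛ; prep; swap; ↭-sym; ↭-refl; ↭-trans)
open import Data.List.Relation.Binary.Permutation.Propositional.Properties using (++⁺; ↭-reverse; shift)
import Data.List.Relation.Binary.Permutation.Setoid.Properties as ↭ₛ
open import Data.Nat
  using (ℕ; zero; suc; _+_; _*_; _^_; _%_; _≤_; _<_; z≤n; s≤s; _≤?_; _<?_; NonZero; >-nonZero⁻¹)
open import Data.Nat.Divisibility using (_∣_; _∣0; ∣m∣n⇒∣m+n; ∣1⇒≡1; n∣m⇒m%n≡0)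
open import Data.Nat.Induction using (<-wellFounded)
open import Data.Nat.Logarithm
  using (⌊log₂_⌋; ⌈log₂_⌉; ⌊log₂⌋-mono-≤; ⌊log₂[2^n]⌋≡n; ⌈log₂2^n⌉≡n)
open import Data.Nat.Properties
  using ( +-suc; ≤-refl; ≤-trans; ≤-antisym; ≮⇒≥; ≰⇒>; n≮n; n≤1+n; n<1+n; m≤m+n
        ; *-mono-≤; *-monoʳ-≤; *-mono-<; *-assoc; ^-monoʳ-≤; ^-distribˡ-+-*; ^-*-assoc; m^n≢0
        ; module ≤-Reasoning )
open import Data.Nat.Solver using (module +-*-Solver)
open import Data.Product using (_×_; _,_; ∃-syntax; proj₁; proj₂)
import Data.Product.Properties as Product
open import Data.Sum using (_⊎_; inj₁; inj₂)
open import Data.Vec using (Vec; []; _∷_; head; lookup; zipWith; toList; tabulate)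
import Data.Vec as Vec
import Data.Vec.Properties as Vecₚ
open import Function using (_∘_; case_of_)
open import Function.Definitions using (Injective)
open import Induction.WellFounded using (Acc; acc)
open import Relation.Binary.Definitions using (DecidableEquality; tri<; tri≈; tri>)
open import Relation.Binary.PropositionalEquality
open import Relation.Nullary using (¬_; yes; no; does; contradiction)
open import Relation.Nullary.Decidable using (T?; dec-true; dec-false)
open import Relation.Unary using (Decidable)
open import Relation.Unary.Properties using (∁?)

open import Defs

¬2∣1 : ¬ 2 ∣ 1
¬2∣1 2∣1 with () ← ∣1⇒≡1 2∣1

-- For `Fin k` with `Data.Fin.Properties._≟_`, `multiplicity` is `Defs.occurrences`.
module Multiplicity {A : Set} (_≟_ : DecidableEquality A) where

  multiplicity : A → List A → ℕ
  multiplicity c xs = length (filter (_≟ c) xs)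

  EvenMultiplicities : List A → Set
  EvenMultiplicities xs = ∀ c → 2 ∣ multiplicity c xs

  module _ {P : A → Set} (P? : Decidable P) where

    multiplicity-filter-accept : ∀ {c} → P c → ∀ xs → multiplicity c (filter P? xs) ≡ multiplicity c xs
    multiplicity-filter-accept pc [] = refl
    multiplicity-filter-accept {c} pc (x ∷ xs) with P? x
    ... | yes _ with x ≟ c
    ...   | yes _ = cong suc (multiplicity-filter-accept pc xs)
    ...   | no _  = multiplicity-filter-accept pc xs
    multiplicity-filter-accept {c} pc (x ∷ xs) | no ¬px with x ≟ c
    ...   | yes refl = contradiction pc ¬px
    ...   | no _     = multiplicity-filter-accept pc xs

    multiplicity-filter-reject : ∀ {c} → ¬ P c → ∀ xs → multiplicity c (filter P? xs) ≡ 0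
    multiplicity-filter-reject ¬pc [] = refl
    multiplicity-filter-reject {c} ¬pc (x ∷ xs) with P? x
    ... | no _ = multiplicity-filter-reject ¬pc xs
    ... | yes px with x ≟ c
    ...   | yes refl = contradiction px ¬pc
    ...   | no _     = multiplicity-filter-reject ¬pc xs

    evenMultiplicities-filter : ∀ {xs} → EvenMultiplicities xs → EvenMultiplicities (filter P? xs)
    evenMultiplicities-filter {xs} even c with P? c
    ... | yes pc = subst (2 ∣_) (sym (multiplicity-filter-accept pc xs)) (even c)
    ... | no ¬pc = subst (2 ∣_) (sym (multiplicity-filter-reject ¬pc xs)) (2 ∣0)

    length-filter+filter-∁ : ∀ xs → length (filter P? xs) + length (filter (∁? P?) xs) ≡ length xs
    length-filter+filter-∁ [] = refl
    length-filter+filter-∁ (x ∷ xs) with P? x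
    ... | yes _ = cong suc (length-filter+filter-∁ xs)
    ... | no _  = trans (+-suc _ _) (cong suc (length-filter+filter-∁ xs))

  evenMultiplicities⇒even-length : ∀ {xs} → EvenMultiplicities xs → 2 ∣ length xs
  evenMultiplicities⇒even-length {xs} = go xs (<-wellFounded (length xs))
    where
    go : ∀ xs → Acc _<_ (length xs) → EvenMultiplicities xs → 2 ∣ length xs
    go [] _ _ = 2 ∣0
    go (x ∷ xs) (acc rec) even =
      subst (2 ∣_) (length-filter+filter-∁ (_≟ x) (x ∷ xs))
        (∣m∣n⇒∣m+n (even x) (go others (rec shorter) othersEven))
      where
      others = filter (∁? (_≟ x)) (x ∷ xs)
      othersEven : EvenMultiplicities others
      othersEven = evenMultiplicities-filter (∁? (_≟ x)) {x ∷ xs} even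
      shorter : length others < length (x ∷ xs)
      shorter = filter-notAll (∁? (_≟ x)) (x ∷ xs) (here λ x≢x → x≢x refl)

  multiplicity-↭ : ∀ {c xs ys} → xs ↭ ys → multiplicity c xs ≡ multiplicity c ys
  multiplicity-↭ {c} xs↭ys =
    ↭ₛ.xs↭ys⇒|xs|≡|ys| (setoid A)
      (↭ₛ.filter⁺ (setoid A) (_≟ c) (subst (_≡ c)) (↭⇒↭ₛ xs↭ys))

  evenMultiplicities-↭ : ∀ {xs ys} → xs ↭ ys → EvenMultiplicities xs → EvenMultiplicities ys
  evenMultiplicities-↭ xs↭ys even c = subst (2 ∣_) (multiplicity-↭ xs↭ys) (even c)

  multiplicity-unique : ∀ {α xs ys} → All (_≢ α) xs → All (_≢ α) ys →
                        multiplicity α (xs ++ α ∷ ys) ≡ 1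
  multiplicity-unique {α} {xs} {ys} xs∌α ys∌α = cong length (begin
    filter (_≟ α) (xs ++ α ∷ ys)
      ≡⟨ filter-++ (_≟ α) xs (α ∷ ys) ⟩
    filter (_≟ α) xs ++ filter (_≟ α) (α ∷ ys)
      ≡⟨ cong₂ _++_ (filter-none (_≟ α) xs∌α) (filter-accept (_≟ α) refl) ⟩
    α ∷ filter (_≟ α) ys
      ≡⟨ cong (α ∷_) (filter-none (_≟ α) ys∌α) ⟩
    α ∷ []
      ∎)
    where open ≡-Reasoning

  evenMultiplicities-pair⇒≡ : ∀ {x y} → EvenMultiplicities (x ∷ y ∷ []) → x ≡ y
  evenMultiplicities-pair⇒≡ {x} {y} even with y ≟ x
  ... | yes y≡x = sym y≡x
  ... | no y≢x  = contradiction (subst (2 ∣_) (multiplicity-unique [] (y≢x ∷ [])) (even x)) ¬2∣1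

module _ {A B : Set} (_≟ᴬ_ : DecidableEquality A) (_≟ᴮ_ : DecidableEquality B) (f : A → B) where
  private
    module MA = Multiplicity _≟ᴬ_
    module MB = Multiplicity _≟ᴮ_

  multiplicity-map : ∀ b xs → MB.multiplicity b (map f xs) ≡ length (filter (λ x → f x ≟ᴮ b) xs)
  multiplicity-map b [] = refl
  multiplicity-map b (x ∷ xs) with f x ≟ᴮ b
  ... | yes _ = cong suc (multiplicity-map b xs)
  ... | no _  = multiplicity-map b xs

  evenMultiplicities-map : ∀ {xs} → MA.EvenMultiplicities xs → MB.EvenMultiplicities (map f xs)
  evenMultiplicities-map {xs} even b = subst (2 ∣_) (sym (multiplicity-map b xs))
    (MA.evenMultiplicities⇒even-length {filter (λ x → f x ≟ᴮ b) xs}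
      (MA.evenMultiplicities-filter (λ x → f x ≟ᴮ b) {xs} even))

  evenMultiplicities-map⁻ : Injective _≡_ _≡_ f → ∀ {xs} →
                            MB.EvenMultiplicities (map f xs) → MA.EvenMultiplicities xs
  evenMultiplicities-map⁻ f-injective {xs} even a = subst (2 ∣_) fibre≡ (even (f a))
    where
    fibre≡ : MB.multiplicity (f a) (map f xs) ≡ MA.multiplicity a xs
    fibre≡ = trans (multiplicity-map (f a) xs)
      (cong length (filter-≐ (λ x → f x ≟ᴮ f a) (_≟ᴬ a) (f-injective , cong f) xs))

open Multiplicity Bool._≟_ using ()
  renaming (multiplicity to multiplicityᵇ; EvenMultiplicities to EvenMultiplicitiesᵇ)

module _ {A : Set} (_≟_ : DecidableEquality A) where
  open Multiplicity _≟_

  multiplicity-indicator : ∀ α xs →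
                           multiplicityᵇ true (map (λ x → does (x ≟ α)) xs) ≡ multiplicity α xs
  multiplicity-indicator α [] = refl
  multiplicity-indicator α (x ∷ xs) with x ≟ α
  ... | yes _ = cong suc (multiplicity-indicator α xs)
  ... | no _  = multiplicity-indicator α xs

  data Classification₄ : A → A → A → A → Set where
    constant    : ∀ {a} → Classification₄ a a a a
    unique      : ∀ {a b c d} α → multiplicity α (a ∷ b ∷ c ∷ d ∷ []) ≡ 1 →
                  Classification₄ a b c d
    pairs-01-23 : ∀ {a c} → c ≢ a → Classification₄ a a c c
    pairs-02-13 : ∀ {a b} → b ≢ a → Classification₄ a b a b
    pairs-03-12 : ∀ {a b} → b ≢ a → Classification₄ a b b a

  classify₄ : ∀ a b c d → Classification₄ a b c d
  classify₄ a b c d with b ≟ a | c ≟ a | d ≟ a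
  ... | yes refl | yes refl | yes refl = constant
  ... | yes refl | yes refl | no d≢a   =
    unique d (multiplicity-unique (≢-sym d≢a ∷ ≢-sym d≢a ∷ ≢-sym d≢a ∷ []) [])
  ... | yes refl | no c≢a   | yes refl =
    unique c (multiplicity-unique (≢-sym c≢a ∷ ≢-sym c≢a ∷ []) (≢-sym c≢a ∷ []))
  ... | no b≢a   | yes refl | yes refl =
    unique b (multiplicity-unique (≢-sym b≢a ∷ []) (≢-sym b≢a ∷ ≢-sym b≢a ∷ []))
  ... | no b≢a   | no c≢a   | no d≢a   = unique a (multiplicity-unique [] (b≢a ∷ c≢a ∷ d≢a ∷ []))
  ... | yes refl | no c≢a   | no d≢a   with d ≟ c
  ...   | yes refl = pairs-01-23 c≢a
  ...   | no d≢c   = unique c (multiplicity-unique (≢-sym c≢a ∷ ≢-sym c≢a ∷ []) (d≢c ∷ []))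
  classify₄ a b c d | no b≢a | yes refl | no d≢a with d ≟ b
  ...   | yes refl = pairs-02-13 b≢a
  ...   | no d≢b   = unique b (multiplicity-unique (≢-sym b≢a ∷ []) (≢-sym b≢a ∷ d≢b ∷ []))
  classify₄ a b c d | no b≢a | no c≢a | yes refl with c ≟ b
  ...   | yes refl = pairs-03-12 b≢a
  ...   | no c≢b   = unique b (multiplicity-unique (≢-sym b≢a ∷ []) (c≢b ∷ ≢-sym b≢a ∷ []))

k4Colours : {V C : Set} → (V → V → C) → Vec V 4 → List C
k4Colours c (x0 ∷ x1 ∷ x2 ∷ x3 ∷ []) =
  c x0 x1 ∷ c x0 x2 ∷ c x0 x3 ∷ c x1 x2 ∷ c x1 x3 ∷ c x2 x3 ∷ []

k4Colours-natural : {U V C D : Set} (c : U → U → C) (c′ : V → V → D) (g : C → D) (h : U → V) →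
                    (∀ x y → g (c x y) ≡ c′ (h x) (h y)) →
                    ∀ xs → map g (k4Colours c xs) ≡ k4Colours c′ (Vec.map h xs)
k4Colours-natural c c′ g h gc≡c′h (x0 ∷ x1 ∷ x2 ∷ x3 ∷ []) =
  cong₂ _∷_ (gc≡c′h x0 x1) (cong₂ _∷_ (gc≡c′h x0 x2) (cong₂ _∷_ (gc≡c′h x0 x3)
    (cong₂ _∷_ (gc≡c′h x1 x2) (cong₂ _∷_ (gc≡c′h x1 x3) (cong₂ _∷_ (gc≡c′h x2 x3) refl)))))

module _ {V C : Set} {c : V → V → C} (c-sym : ∀ x y → c x y ≡ c y x) where

  k4Colours-swap₁₂ : ∀ x0 x1 x2 x3 →
                     k4Colours c (x0 ∷ x1 ∷ x2 ∷ x3 ∷ []) ↭ k4Colours c (x0 ∷ x2 ∷ x1 ∷ x3 ∷ [])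
  k4Colours-swap₁₂ x0 x1 x2 x3 rewrite c-sym x2 x1 = swap _ _ (prep _ (prep _ (swap _ _ ↭-refl)))

  k4Colours-swap₁₃ : ∀ x0 x1 x2 x3 →
                     k4Colours c (x0 ∷ x1 ∷ x2 ∷ x3 ∷ []) ↭ k4Colours c (x0 ∷ x3 ∷ x2 ∷ x1 ∷ [])
  k4Colours-swap₁₃ x0 x1 x2 x3 rewrite c-sym x3 x2 | c-sym x3 x1 | c-sym x2 x1 =
    ++⁺ (↭-sym (↭-reverse (c x0 x1 ∷ c x0 x2 ∷ c x0 x3 ∷ [])))
        (↭-sym (↭-reverse (c x1 x2 ∷ c x1 x3 ∷ c x2 x3 ∷ [])))

  k4Colours-swapPairs : ∀ x0 x1 x2 x3 →
                        k4Colours c (x0 ∷ x1 ∷ x2 ∷ x3 ∷ []) ↭ k4Colours c (x2 ∷ x3 ∷ x0 ∷ x1 ∷ [])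
  k4Colours-swapPairs x0 x1 x2 x3 rewrite c-sym x2 x0 | c-sym x2 x1 | c-sym x3 x0 | c-sym x3 x1 =
    ↭-trans (shift (c x2 x3) (c x0 x1 ∷ c x0 x2 ∷ c x0 x3 ∷ c x1 x2 ∷ c x1 x3 ∷ []) [])
      (prep _ (↭-trans (prep _ (prep _ (swap _ _ ↭-refl)))
                       (↭-sym (shift (c x0 x1) (c x0 x2 ∷ c x1 x2 ∷ c x0 x3 ∷ c x1 x3 ∷ []) []))))

-- k(4 − k) ≡ k (mod 2), where k is the number of true indicators.
k4Colours-xor-parity : ∀ e0 e1 e2 e3 →
  multiplicityᵇ true (k4Colours _xor_ (e0 ∷ e1 ∷ e2 ∷ e3 ∷ [])) % 2 ≡
  multiplicityᵇ true (e0 ∷ e1 ∷ e2 ∷ e3 ∷ []) % 2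
k4Colours-xor-parity false false false false = refl
k4Colours-xor-parity false false false true  = refl
k4Colours-xor-parity false false true  false = refl
k4Colours-xor-parity false false true  true  = refl
k4Colours-xor-parity false true  false false = refl
k4Colours-xor-parity false true  false true  = refl
k4Colours-xor-parity false true  true  false = refl
k4Colours-xor-parity false true  true  true  = refl
k4Colours-xor-parity true  false false false = refl
k4Colours-xor-parity true  false false true  = refl
k4Colours-xor-parity true  false true  false = refl
k4Colours-xor-parity true  false true  true  = refl
k4Colours-xor-parity true  true  false false = refl
k4Colours-xor-parity true  true  false true  = refl
k4Colours-xor-parity true  true  true  false = refl
k4Colours-xor-parity true  true  true  true  = refl

SamePair : {A : Set} → A → A → A → A → Set
SamePair p q r s = (r ≡ p × s ≡ q) ⊎ (r ≡ q × s ≡ p)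

module FirstDifference (m : ℕ) .{{_ : NonZero m}} where

  Vertex : ℕ → Set
  Vertex = Vec (Fin m)

  Colour : ℕ → Set
  Colour d = Fin m × Fin m × Vec Bool d

  low high : ∀ {d} → Colour d → Fin m
  low  = proj₁
  high = proj₁ ∘ proj₂

  lessBits : ∀ {d} → Colour d → Vec Bool d
  lessBits = proj₂ ∘ proj₂

  _≟ᶜ_ : ∀ {d} → DecidableEquality (Colour d)
  _≟ᶜ_ = Product.≡-dec _≟_ (Product.≡-dec _≟_ (Vecₚ.≡-dec Bool._≟_))

  module ColourMultiplicity {d} = Multiplicity (_≟ᶜ_ {d})
  open ColourMultiplicity using (evenMultiplicities-filter; evenMultiplicities-pair⇒≡; evenMultiplicities-↭)
    renaming (EvenMultiplicities to EvenMultiplicitiesᶜ)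
  open Multiplicity (_≟_ {m}) using () renaming (multiplicity to multiplicityᶠ)

  _<ᵇ_ : Fin m → Fin m → Bool
  a <ᵇ b = does (a Fin.<? b)

  _==_ : Fin m → Fin m → Bool
  a == α = does (a ≟ α)

  lessAt : ∀ {d} → Vertex d → Vertex d → Vec Bool d
  lessAt = zipWith _<ᵇ_

  descend : ∀ {d} → Colour d → Colour (suc d)
  descend (lo , hi , bits) = lo , hi , false ∷ bits

  colour : ∀ {d} → Vertex d → Vertex d → Colour d
  colour [] [] = junk , junk , []
    where junk = fromℕ< (>-nonZero⁻¹ m)
  colour (a ∷ u) (b ∷ v) with <-cmp a b
  ... | tri< _ _ _ = a , b , true ∷ lessAt u v
  ... | tri≈ _ _ _ = descend (colour u v)
  ... | tri> _ _ _ = b , a , true ∷ lessAt v u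

  headsDiffer : ∀ {d} → Colour (suc d) → Bool
  headsDiffer = head ∘ lessBits

  colour-≡ : ∀ {d} a (u v : Vertex d) → colour (a ∷ u) (a ∷ v) ≡ descend (colour u v)
  colour-≡ a u v with <-cmp a a
  ... | tri< a<a _ _ = contradiction a<a (<-irrefl refl)
  ... | tri≈ _ _ _   = refl
  ... | tri> _ _ a<a = contradiction a<a (<-irrefl refl)

  colour-< : ∀ {d a b} → a Fin.< b → (u v : Vertex d) →
             colour (a ∷ u) (b ∷ v) ≡ (a , b , true ∷ lessAt u v)
  colour-< {a = a} {b} a<b u v with <-cmp a b
  ... | tri< _ _ _   = refl
  ... | tri≈ _ a≡b _ = contradiction a≡b (λ { refl → <-irrefl refl a<b })
  ... | tri> _ _ b<a = contradiction b<a (<-asym a<b)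

  colour-> : ∀ {d a b} → b Fin.< a → (u v : Vertex d) →
             colour (a ∷ u) (b ∷ v) ≡ (b , a , true ∷ lessAt v u)
  colour-> {a = a} {b} b<a u v with <-cmp a b
  ... | tri< a<b _ _ = contradiction b<a (<-asym a<b)
  ... | tri≈ _ a≡b _ = contradiction a≡b (λ { refl → <-irrefl refl b<a })
  ... | tri> _ _ _   = refl

  colour-sym : ∀ {d} (x y : Vertex d) → colour x y ≡ colour y x
  colour-sym [] [] = refl
  colour-sym (a ∷ u) (b ∷ v) with <-cmp a b
  ... | tri< a<b _ _  = sym (colour-> a<b v u)
  ... | tri≈ _ refl _ = trans (cong descend (colour-sym u v)) (sym (colour-≡ a v u))
  ... | tri> _ _ b<a  = sym (colour-< b<a v u)

  descend-injective : ∀ {d} → Injective _≡_ _≡_ (descend {d})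
  descend-injective refl = refl

  colour-samePair : ∀ {d} {u v u′ v′ : Vertex d} → u ≢ v → colour u v ≡ colour u′ v′ →
    ∃[ j ] (lookup u j ≢ lookup v j × SamePair (lookup u j) (lookup v j) (lookup u′ j) (lookup v′ j))
  colour-samePair {u = []} {[]} u≢v _ = contradiction refl u≢v
  colour-samePair {u = a ∷ u} {b ∷ v} {a′ ∷ u′} {b′ ∷ v′} u≢v same with <-cmp a b | <-cmp a′ b′
  ... | tri< _ a≢b _ | tri< _ _ _ = zero , a≢b , inj₁ (sym (cong low same) , sym (cong high same))
  ... | tri< _ a≢b _ | tri> _ _ _ = zero , a≢b , inj₂ (sym (cong high same) , sym (cong low same))
  ... | tri> _ a≢b _ | tri< _ _ _ = zero , a≢b , inj₂ (sym (cong low same) , sym (cong high same))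
  ... | tri> _ a≢b _ | tri> _ _ _ = zero , a≢b , inj₁ (sym (cong high same) , sym (cong low same))
  ... | tri≈ _ refl _ | tri≈ _ refl _
    with j , uj≢vj , pair ← colour-samePair {u′ = u′} {v′} (u≢v ∘ cong (a ∷_))
                                             (descend-injective same)
    = suc j , uj≢vj , pair
  ... | tri≈ _ _ _ | tri< _ _ _ = contradiction (cong headsDiffer same) λ ()
  ... | tri≈ _ _ _ | tri> _ _ _ = contradiction (cong headsDiffer same) λ ()
  ... | tri< _ _ _ | tri≈ _ _ _ = contradiction (cong headsDiffer same) λ ()
  ... | tri> _ _ _ | tri≈ _ _ _ = contradiction (cong headsDiffer same) λ ()

  <ᵇ-irrefl : ∀ a → a <ᵇ a ≡ false
  <ᵇ-irrefl a = dec-false (a Fin.<? a) (<-irrefl refl)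

  <ᵇ-flip : ∀ {a b} → a ≢ b → b <ᵇ a ≡ not (a <ᵇ b)
  <ᵇ-flip {a} {b} a≢b with <-cmp a b
  ... | tri< a<b _ b≮a rewrite dec-false (b Fin.<? a) b≮a | dec-true (a Fin.<? b) a<b = refl
  ... | tri≈ _ a≡b _   = contradiction a≡b a≢b
  ... | tri> a≮b _ b<a rewrite dec-true (b Fin.<? a) b<a | dec-false (a Fin.<? b) a≮b = refl

  crossComparisons-once : ∀ {p q r s} → p ≢ q → SamePair p q r s →
                          multiplicityᵇ true (p <ᵇ r ∷ p <ᵇ s ∷ q <ᵇ r ∷ q <ᵇ s ∷ []) ≡ 1
  crossComparisons-once {p} {q} p≢q (inj₁ (refl , refl))
    rewrite <ᵇ-irrefl p | <ᵇ-irrefl q | <ᵇ-flip p≢q with p <ᵇ q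
  ... | true  = refl
  ... | false = refl
  crossComparisons-once {p} {q} p≢q (inj₂ (refl , refl))
    rewrite <ᵇ-irrefl p | <ᵇ-irrefl q | <ᵇ-flip p≢q with p <ᵇ q
  ... | true  = refl
  ... | false = refl

  lessAt-once : ∀ {d} {u0 u1 u2 u3 : Vertex d} j → lookup u0 j ≢ lookup u1 j →
                SamePair (lookup u0 j) (lookup u1 j) (lookup u2 j) (lookup u3 j) →
                multiplicityᵇ true (lookup (lessAt u0 u2) j ∷ lookup (lessAt u0 u3) j ∷
                                    lookup (lessAt u1 u2) j ∷ lookup (lessAt u1 u3) j ∷ []) ≡ 1
  lessAt-once {u0 = u0} {u1} {u2} {u3} j p≢q pair
    rewrite Vecₚ.lookup-zipWith _<ᵇ_ j u0 u2 | Vecₚ.lookup-zipWith _<ᵇ_ j u0 u3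
          | Vecₚ.lookup-zipWith _<ᵇ_ j u1 u2 | Vecₚ.lookup-zipWith _<ᵇ_ j u1 u3
          = crossComparisons-once p≢q pair

  orderedPairs⇒¬evenChromatic : ∀ {d a b} {u0 u1 u2 u3 : Vertex d} → a Fin.< b → u0 ≢ u1 →
    ¬ EvenMultiplicitiesᶜ (k4Colours colour ((a ∷ u0) ∷ (a ∷ u1) ∷ (b ∷ u2) ∷ (b ∷ u3) ∷ []))
  orderedPairs⇒¬evenChromatic {d} {a} {b} {u0} {u1} {u2} {u3} a<b u0≢u1 even =
    let j , pj≢qj , pair = colour-samePair {u = u0} {u1} {u2} {u3} u0≢u1
                             (descend-injective (evenMultiplicities-pair⇒≡ innerEven))
    in contradiction
         (subst (2 ∣_) (lessAt-once {u0 = u0} {u1} {u2} {u3} j pj≢qj pair) (crossBitsEven j true))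
         ¬2∣1
    where
    cross : Vertex d → Vertex d → Colour (suc d)
    cross u v = a , b , true ∷ lessAt u v
    colours : List (Colour (suc d))
    colours = descend (colour u0 u1) ∷ cross u0 u2 ∷ cross u0 u3 ∷
              cross u1 u2 ∷ cross u1 u3 ∷ descend (colour u2 u3) ∷ []
    even′ : EvenMultiplicitiesᶜ colours
    even′ = subst EvenMultiplicitiesᶜ
      (cong₂ _∷_ (colour-≡ a u0 u1) (cong₂ _∷_ (colour-< a<b u0 u2) (cong₂ _∷_ (colour-< a<b u0 u3)
        (cong₂ _∷_ (colour-< a<b u1 u2) (cong₂ _∷_ (colour-< a<b u1 u3)
          (cong₂ _∷_ (colour-≡ b u2 u3) refl))))))
      even
    innerEven : EvenMultiplicitiesᶜ (descend (colour u0 u1) ∷ descend (colour u2 u3) ∷ [])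
    innerEven = evenMultiplicities-filter (T? ∘ not ∘ headsDiffer) {colours} even′
    bitAt : Fin d → Colour (suc d) → Bool
    bitAt j c = lookup (lessBits c) (suc j)
    crossBitsEven : ∀ j → EvenMultiplicitiesᵇ (map (bitAt j) (filterᵇ headsDiffer colours))
    crossBitsEven j = evenMultiplicities-map _≟ᶜ_ Bool._≟_ (bitAt j) {filterᵇ headsDiffer colours}
                        (evenMultiplicities-filter (T? ∘ headsDiffer) {colours} even′)

  twoPairs⇒¬evenChromatic : ∀ {d a b} {u0 u1 u2 u3 : Vertex d} → b ≢ a → u0 ≢ u1 → u2 ≢ u3 →
    ¬ EvenMultiplicitiesᶜ (k4Colours colour ((a ∷ u0) ∷ (a ∷ u1) ∷ (b ∷ u2) ∷ (b ∷ u3) ∷ []))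
  twoPairs⇒¬evenChromatic {a = a} {b} {u0} {u1} {u2} {u3} b≢a u0≢u1 u2≢u3 = case <-cmp a b of λ where
    (tri< a<b _ _) → orderedPairs⇒¬evenChromatic a<b u0≢u1
    (tri≈ _ a≡b _) → contradiction (sym a≡b) b≢a
    (tri> _ _ b<a) → orderedPairs⇒¬evenChromatic b<a u2≢u3
                   ∘ evenMultiplicities-↭
                       (k4Colours-swapPairs colour-sym (a ∷ u0) (a ∷ u1) (b ∷ u2) (b ∷ u3))

  separates : Fin m → ∀ {d} → Colour (suc d) → Bool
  separates α c = headsDiffer c ∧ (low c == α ∨ high c == α)

  ∨≡xor : ∀ {a b} α → a ≢ b → (a == α) ∨ (b == α) ≡ (a == α) xor (b == α)
  ∨≡xor {a} {b} α a≢b with a ≟ α | b ≟ α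
  ... | yes refl | yes refl = contradiction refl a≢b
  ... | yes _    | no _     = refl
  ... | no _     | yes _    = refl
  ... | no _     | no _     = refl

  separates-colour : ∀ α {d} (x y : Vertex (suc d)) →
                     separates α (colour x y) ≡ (head x == α) xor (head y == α)
  separates-colour α (a ∷ u) (b ∷ v) with <-cmp a b
  ... | tri< _ a≢b _  = ∨≡xor α a≢b
  ... | tri≈ _ refl _ = sym (Bool.xor-same (a == α))
  ... | tri> _ a≢b _  = trans (Bool.∨-comm (b == α) (a == α)) (∨≡xor α a≢b)

  uniqueHead⇒¬evenChromatic : ∀ {d} α (xs : Vec (Vertex (suc d)) 4) →
    multiplicityᶠ α (toList (Vec.map head xs)) ≡ 1 → ¬ EvenMultiplicitiesᶜ (k4Colours colour xs)
  uniqueHead⇒¬evenChromatic α xs@(x0 ∷ x1 ∷ x2 ∷ x3 ∷ []) once even = contradiction parity λ ()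
    where
    isα : Vertex _ → Bool
    isα x = head x == α
    separatedEven : 2 ∣ multiplicityᵇ true (k4Colours _xor_ (Vec.map isα xs))
    separatedEven = subst (λ bs → 2 ∣ multiplicityᵇ true bs)
      (k4Colours-natural colour _xor_ (separates α) isα (separates-colour α) xs)
      (evenMultiplicities-map _≟ᶜ_ Bool._≟_ (separates α) {k4Colours colour xs} even true)
    parity : 1 % 2 ≡ 0
    parity = begin
      1 % 2                                                         ≡⟨ cong (_% 2) once ⟨
      multiplicityᶠ α (head x0 ∷ head x1 ∷ head x2 ∷ head x3 ∷ []) % 2
        ≡⟨ cong (_% 2) (multiplicity-indicator _≟_ α (head x0 ∷ head x1 ∷ head x2 ∷ head x3 ∷ [])) ⟨
      multiplicityᵇ true (isα x0 ∷ isα x1 ∷ isα x2 ∷ isα x3 ∷ []) % 2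
        ≡⟨ k4Colours-xor-parity (isα x0) (isα x1) (isα x2) (isα x3) ⟨
      multiplicityᵇ true (k4Colours _xor_ (Vec.map isα xs)) % 2    ≡⟨ n∣m⇒m%n≡0 _ 2 separatedEven ⟩
      0                                                             ∎
      where open ≡-Reasoning

  k4Colours-descend : ∀ {d} a (ts : Vec (Vertex d) 4) →
                      k4Colours colour (Vec.map (a ∷_) ts) ≡ map descend (k4Colours colour ts)
  k4Colours-descend a ts =
    sym (k4Colours-natural colour colour descend (a ∷_) (λ u v → sym (colour-≡ a u v)) ts)

  noEvenChromaticK4 : ∀ {d} (xs : Vec (Vertex d) 4) → Injective _≡_ _≡_ (lookup xs) →
                      ¬ EvenMultiplicitiesᶜ (k4Colours colour xs)
  noEvenChromaticK4 ([] ∷ [] ∷ _ ∷ _ ∷ []) distinct _ = contradiction (distinct {0F} {1F} refl) λ ()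
  noEvenChromaticK4 xs@((a0 ∷ t0) ∷ (a1 ∷ t1) ∷ (a2 ∷ t2) ∷ (a3 ∷ t3) ∷ []) distinct
    with classify₄ _≟_ a0 a1 a2 a3
  ... | constant = noEvenChromaticK4 ts tails-distinct
                 ∘ evenMultiplicities-map⁻ _≟ᶜ_ _≟ᶜ_ descend descend-injective {k4Colours colour ts}
                 ∘ subst EvenMultiplicitiesᶜ (k4Colours-descend a0 ts)
    where
    ts = t0 ∷ t1 ∷ t2 ∷ t3 ∷ []
    tails-distinct : Injective _≡_ _≡_ (lookup ts)
    tails-distinct {i} {j} e = distinct (trans (Vecₚ.lookup-map i (a0 ∷_) ts)
                                 (trans (cong (a0 ∷_) e) (sym (Vecₚ.lookup-map j (a0 ∷_) ts))))
  ... | unique α once = uniqueHead⇒¬evenChromatic α xs once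
  ... | pairs-01-23 c≢a =
    twoPairs⇒¬evenChromatic c≢a (λ e → contradiction (distinct {0F} {1F} (cong (a0 ∷_) e)) λ ())
                                (λ e → contradiction (distinct {2F} {3F} (cong (a2 ∷_) e)) λ ())
  ... | pairs-02-13 b≢a =
    twoPairs⇒¬evenChromatic b≢a (λ e → contradiction (distinct {0F} {2F} (cong (a0 ∷_) e)) λ ())
                                (λ e → contradiction (distinct {1F} {3F} (cong (a1 ∷_) e)) λ ())
    ∘ evenMultiplicities-↭ (k4Colours-swap₁₂ colour-sym (a0 ∷ t0) (a1 ∷ t1) (a0 ∷ t2) (a1 ∷ t3))
  ... | pairs-03-12 b≢a =
    twoPairs⇒¬evenChromatic b≢a (λ e → contradiction (distinct {0F} {3F} (cong (a0 ∷_) e)) λ ())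
                                (λ e → contradiction (distinct {2F} {1F} (cong (a1 ∷_) e)) λ ())
    ∘ evenMultiplicities-↭ (k4Colours-swap₁₃ colour-sym (a0 ∷ t0) (a1 ∷ t1) (a1 ∷ t2) (a0 ∷ t3))

  bitToFin : Bool → Fin 2
  bitToFin false = 0F
  bitToFin true  = 1F

  bitToFin-injective : Injective _≡_ _≡_ bitToFin
  bitToFin-injective {false} {false} _ = refl
  bitToFin-injective {true}  {true}  _ = refl

  encodeBits : ∀ {d} → Vec Bool d → Fin (2 ^ d)
  encodeBits []       = zero
  encodeBits (b ∷ bs) = combine (bitToFin b) (encodeBits bs)

  encodeBits-injective : ∀ {d} → Injective _≡_ _≡_ (encodeBits {d})
  encodeBits-injective {x = []} {[]} _ = refl
  encodeBits-injective {x = b ∷ bs} {b′ ∷ bs′} e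
    with b≡b′ , bs≡bs′ ← combine-injective (bitToFin b) _ (bitToFin b′) _ e
    = cong₂ _∷_ (bitToFin-injective b≡b′) (encodeBits-injective bs≡bs′)

  encode : ∀ {d} → Colour d → Fin (m * m * 2 ^ d)
  encode (lo , hi , bits) = combine (combine lo hi) (encodeBits bits)

  encode-injective : ∀ {d} → Injective _≡_ _≡_ (encode {d})
  encode-injective {x = lo , hi , bits} {lo′ , hi′ , bits′} e
    with heads≡ , bits≡ ← combine-injective (combine lo hi) _ (combine lo′ hi′) _ e
    with refl , refl ← combine-injective lo hi lo′ hi′ heads≡
    = cong (λ bs → lo , hi , bs) (encodeBits-injective bits≡)

funToFin-cong : ∀ {d m} {f g : Fin d → Fin m} → (∀ i → f i ≡ g i) → funToFin f ≡ funToFin g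
funToFin-cong {zero}  _   = refl
funToFin-cong {suc d} f≗g = cong₂ combine (f≗g zero) (funToFin-cong (f≗g ∘ suc))

toVertex : ∀ {m d} → Fin (m ^ d) → Vec (Fin m) d
toVertex i = tabulate (finToFun i)

toVertex-injective : ∀ {m d} → Injective _≡_ _≡_ (toVertex {m} {d})
toVertex-injective {m} {d} {i} {j} e = begin
  i                       ≡⟨ fromVertex-toVertex i ⟨
  fromVertex (toVertex i) ≡⟨ cong fromVertex e ⟩
  fromVertex (toVertex j) ≡⟨ fromVertex-toVertex j ⟩
  j                       ∎
  where
  open ≡-Reasoning
  fromVertex : Vec (Fin m) d → Fin (m ^ d)
  fromVertex = funToFin ∘ lookup
  fromVertex-toVertex : ∀ (k : Fin (m ^ d)) → fromVertex (toVertex k) ≡ k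
  fromVertex-toVertex k =
    trans (funToFin-cong {d} {m} (Vecₚ.lookup∘tabulate (finToFun k))) (funToFin-finToFin {d} {m} k)

rK4AtMost-power : ∀ m d {n} .{{_ : NonZero m}} → n ≤ m ^ d → RK4AtMost n (m * m * 2 ^ d)
rK4AtMost-power m d {n} n≤m^d = χ , λ (f , f-injective , even) →
  noEvenChromaticK4 (tabulate (embed ∘ f)) (distinct f-injective)
    (evenMultiplicities-map⁻ _≟ᶜ_ _≟_ encode encode-injective
       {k4Colours colour (tabulate (embed ∘ f))} even)
  where
  open FirstDifference m
  embed : Fin n → Vertex d
  embed i = toVertex (inject≤ i n≤m^d)
  embed-injective : Injective _≡_ _≡_ embed
  embed-injective = inject≤-injective n≤m^d n≤m^d _ _ ∘ toVertex-injective
  χ : Coloring n (m * m * 2 ^ d)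
  χ = record { col  = λ i j → encode (colour (embed i) (embed j))
             ; symm = λ i j → cong encode (colour-sym (embed i) (embed j)) }
  distinct : ∀ {f : Fin 4 → Fin n} → Injective _≡_ _≡_ f →
             Injective _≡_ _≡_ (lookup (tabulate (embed ∘ f)))
  distinct {f} f-injective {i} {j} e = f-injective (embed-injective
    (trans (sym (Vecₚ.lookup∘tabulate (embed ∘ f) i)) (trans e (Vecₚ.lookup∘tabulate (embed ∘ f) j))))

open +-*-Solver using (solve; _:+_; _:*_; con; _:=_)

n<2^[1+⌊log₂n⌋] : ∀ n → n < 2 ^ suc ⌊log₂ n ⌋
n<2^[1+⌊log₂n⌋] n with 2 ^ suc ⌊log₂ n ⌋ ≤? n
... | yes 2^[1+L]≤n =
  contradiction (subst (_≤ ⌊log₂ n ⌋) (⌊log₂[2^n]⌋≡n _) (⌊log₂⌋-mono-≤ 2^[1+L]≤n)) (n≮n _)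
... | no 2^[1+L]≰n  = ≰⇒> 2^[1+L]≰n

square-between : ∀ L → 1 ≤ L → ∃[ s ] (L < s * s × s * s ≤ 4 * L)
square-between (suc zero) _ = 2 , s≤s (s≤s z≤n) , ≤-refl
square-between (suc (suc L)) _ with square-between (suc L) (s≤s z≤n)
... | suc t , L<s² , s²≤4L with suc (suc L) <? suc t * suc t
...   | yes L′<s² = suc t , L′<s² , ≤-trans s²≤4L (*-monoʳ-≤ 4 (n≤1+n (suc L)))
...   | no L′≮s²  = suc (suc t) , L′<s′² , s′²≤4L′
  where
  s²≡L′ : suc t * suc t ≡ suc (suc L)
  s²≡L′ = ≤-antisym (≮⇒≥ L′≮s²) L<s²
  L′<s′² : suc (suc L) < suc (suc t) * suc (suc t)
  L′<s′² = subst (_< suc (suc t) * suc (suc t)) s²≡L′ (*-mono-< (n<1+n (suc t)) (n<1+n (suc t)))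
  s′²≤4L′ : suc (suc t) * suc (suc t) ≤ 4 * suc (suc L)
  s′²≤4L′ = begin
    suc (suc t) * suc (suc t) ≤⟨ *-mono-≤ 2+t≤2+2t 2+t≤2+2t ⟩
    (2 + 2 * t) * (2 + 2 * t) ≡⟨ solve 1 (λ t → (con 2 :+ con 2 :* t) :* (con 2 :+ con 2 :* t)
                                                := con 4 :* ((con 1 :+ t) :* (con 1 :+ t))) refl t ⟩
    4 * (suc t * suc t)       ≡⟨ cong (4 *_) s²≡L′ ⟩
    4 * suc (suc L)           ∎
    where
    open ≤-Reasoning
    2+t≤2+2t : suc (suc t) ≤ 2 + 2 * t
    2+t≤2+2t = s≤s (s≤s (m≤m+n t (t + 0)))

n≤[2^s]^s : ∀ n s → ⌊log₂ n ⌋ < s * s → n ≤ (2 ^ s) ^ s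
n≤[2^s]^s n s L<s² = begin
  n                 <⟨ n<2^[1+⌊log₂n⌋] n ⟩
  2 ^ suc ⌊log₂ n ⌋ ≤⟨ ^-monoʳ-≤ 2 L<s² ⟩
  2 ^ (s * s)       ≡⟨ ^-*-assoc 2 s s ⟨
  (2 ^ s) ^ s       ∎
  where open ≤-Reasoning

log-colours-bound : ∀ s L → s * s ≤ 4 * L → ⌈log₂ (2 ^ s * 2 ^ s * 2 ^ s) ⌉ ^ 2 ≤ 36 * L
log-colours-bound s L s²≤4L = begin
  ⌈log₂ (2 ^ s * 2 ^ s * 2 ^ s) ⌉ ^ 2 ≡⟨ cong (λ k → ⌈log₂ k ⌉ ^ 2) colours≡ ⟩
  ⌈log₂ (2 ^ (s + s + s)) ⌉ ^ 2       ≡⟨ cong (_^ 2) (⌈log₂2^n⌉≡n (s + s + s)) ⟩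
  (s + s + s) ^ 2                     ≡⟨ solve 1 (λ s → (s :+ s :+ s) :* ((s :+ s :+ s) :* con 1)
                                                    := con 9 :* (s :* s)) refl s ⟩
  9 * (s * s)                         ≤⟨ *-monoʳ-≤ 9 s²≤4L ⟩
  9 * (4 * L)                         ≡⟨ *-assoc 9 4 L ⟨
  36 * L                              ∎
  where
  open ≤-Reasoning
  colours≡ : 2 ^ s * 2 ^ s * 2 ^ s ≡ 2 ^ (s + s + s)
  colours≡ = trans (cong (_* 2 ^ s) (sym (^-distribˡ-+-* 2 s s))) (sym (^-distribˡ-+-* 2 (s + s) s))

proposition3p3 : ∃[ C ] (0 < C × ((n : ℕ) → 2 ≤ n →
                   ∃[ k ] (RK4AtMost n k × ⌈log₂ k ⌉ ^ 2 ≤ C * ⌊log₂ n ⌋)))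
proposition3p3 = 36 , s≤s z≤n , λ n 2≤n →
  let s , L<s² , s²≤4L = square-between ⌊log₂ n ⌋ (⌊log₂⌋-mono-≤ 2≤n)
  in 2 ^ s * 2 ^ s * 2 ^ s
   , rK4AtMost-power (2 ^ s) s {{m^n≢0 2 s}} (n≤[2^s]^s n s L<s²)
   , log-colours-bound s ⌊log₂ n ⌋ s²≤4L
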